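{- Let $A$ be an infinite subset of $\mathbb{Z}_{>0}$ with $\gcd(A)=1$, and for $n\geq0$ let $p(n)=p_A(n)$ be the number of partitions of $n$ into parts belonging to $A$ (with $p(0)=1$). Then for each positive integer $h$, \[ \lim_{n\to\infty}\frac{p(0)+\dots+p(n+h)}{p(0)+\dots+p(n)}=1. \] -}

module Defs where

open import Data.Bool using (Bool; true; false; if_then_else_)
open import Data.Nat as ℕ using (ℕ; zero; suc; _+_; _*_; _∸_; _≤_; _≤ᵇ_)
open import Data.Nat.Divisibility using (_∣_)
open import Data.Nat.Properties using (≤-trans; m≤m+n; ≤-refl)
open import Data.List using (List; []; _∷_; _++_; map; concatMap; length; replicate; upTo)
open import Data.Integer using (+_)
open import Data.Rational using (ℚ; _/_)
open import Data.Rational as Q using (0ℚ; 1ℚ; _-_; ∣_∣; _<_)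
open import Data.Product using (∃-syntax; _×_)
open import Relation.Binary.PropositionalEquality using (_≡_; refl)

Subset : Set
Subset = ℕ → Bool

_∈_ : ℕ → Subset → Set
n ∈ A = A n ≡ true

-- A ⊆ ℤ_{>0}
PositiveSubset : Subset → Set
PositiveSubset A = A 0 ≡ false

Infinite : Subset → Set
Infinite A = ∀ m → ∃[ n ] (m ≤ n × n ∈ A)

GcdOne : Subset → Set
GcdOne A = ∀ d → (∀ a → a ∈ A → d ∣ a) → d ≡ 1

-- parts A k n : the list of all partitions of n into parts belonging to A,
-- each part ≤ k, each partition written as a non-increasing list of parts.
-- (A partition with largest allowed part size k+1 uses that part j times,
--  j = 0,1,..., with j*(k+1) ≤ n.)
parts : Subset → ℕ → ℕ → List (List ℕ)
parts A zero zero = [] ∷ []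
parts A zero (suc n) = []
parts A (suc k) n =
  concatMap
    (λ j → if (j * suc k ≤ᵇ n) ∧' (j ≡0∨ A (suc k))
           then map (replicate j (suc k) ++_) (parts A k (n ∸ j * suc k))
           else [])
    (upTo (suc n))
  where
  _∧'_ : Bool → Bool → Bool
  true ∧' b = b
  false ∧' b = false
  _≡0∨_ : ℕ → Bool → Bool
  zero ≡0∨ b = true
  suc _ ≡0∨ b = b

-- p_A(n): number of partitions of n into parts from A (all parts are ≤ n).
p : Subset → ℕ → ℕ
p A n = length (parts A n n)

S : Subset → ℕ → ℕ
S A zero = p A 0
S A (suc n) = S A n + p A (suc n)

S≥1 : ∀ A n → 1 ≤ S A n
S≥1 A zero = ℕ.s≤s ℕ.z≤n
S≥1 A (suc n) = ≤-trans (S≥1 A n) (m≤m+n (S A n) (p A (suc n)))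

ratio : Subset → ℕ → ℕ → ℚ
ratio A h n = _/_ (+ S A (n + h)) (S A n) {{ℕ.>-nonZero (S≥1 A n)}}

ConvergesTo : (ℕ → ℚ) → ℚ → Set
ConvergesTo f L = ∀ (ε : ℚ) → 0ℚ < ε → ∃[ N ] (∀ n → N ≤ n → ∣ f n - L ∣ < ε)

-- The heart of the proof is that for every M,
-- eventually p(n + 1) · M ≤ 3 S(n); summing over n + 1, …, n + j then gives
-- S(n + j) · M ≤ S(n) · M + 3 j S(n + j), so S(n + j) / S(n) → 1.
--
-- For the bound, pick k such that A ∩ [1, k] has at least M² + M elements and
-- let N ≥ k³ M.  Each partition of N is sent injectively, in one of three ways,
-- into partitions of smaller numbers, of which there are S(N - 1):
--  * if it uses at least M distinct parts from A ∩ [1, k], remove one copy of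
--    any of them (M images, no label needed since the part is N minus the weight);
--  * otherwise, if it has a part b > k, exchange one copy of b for any of the
--    at least M² parts of A ∩ [1, k] it misses (the images, labelled by that part,
--    use fewer than M + 1 such parts, so there are at most M · S(N - 1) of them);
--  * otherwise all parts are ≤ k, so some part a ≤ k occurs at least N / k² ≥ k M
--    times; remove 1, …, k M copies of it (images labelled by a ≤ k).
-- Each case contributes at most S(N - 1) / M partitions of N.

module Submission where

open import Defs hiding (_∈_)
open import Data.Bool using (Bool; true; false; if_then_else_; _∧_; _∨_)
open import Data.Bool.Properties using (T-≡)
open import Function.Bundles using (Equivalence)
import Data.Bool as Bool
open import Data.Empty using (⊥; ⊥-elim)
open import Data.List using (List; []; _∷_; _++_; map; concatMap; length; upTo; applyUpTo; replicate; filter; _∷ʳ_)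
open import Data.List.Properties
  using (length-++; length-map; length-filter; length-upTo; length-applyUpTo; length-removeAt′;
         filter-++; filter-accept; upTo-∷ʳ; applyUpTo-∷ʳ; concatMap-++)
open import Data.List.Membership.Propositional using (_∈_; _─_)
open import Data.List.Membership.Propositional.Properties
open import Data.List.Relation.Unary.Any as Any using (here; there)
open import Data.List.Relation.Unary.All as All using (All)
open import Data.List.Relation.Unary.Unique.Propositional using (Unique; []; _∷_)
import Data.List.Relation.Unary.Unique.Propositional.Properties as Unique
import Data.Nat as ℕ
open import Data.Nat
  using (ℕ; zero; suc; _+_; _*_; _∸_; _≤_; _<_; z≤n; s≤s; _≤ᵇ_; _≡ᵇ_; _≟_; _≤?_; _<?_;
         >-nonZero; _≤′_; ≤′-refl; ≤′-step)
open import Data.Nat.Properties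
open import Data.Vec using (Vec; []; _∷_)
open import Data.Vec.Properties using (∷-injective)
open import Data.Product using (Σ; ∃-syntax; _×_; _,_; proj₁; proj₂)
open import Data.Sum using (inj₁; inj₂)
open import Relation.Binary.PropositionalEquality
  using (_≡_; _≢_; refl; sym; trans; cong; cong₂; subst; subst₂; module ≡-Reasoning)
open import Relation.Nullary using (yes; no; does)
open import Relation.Nullary.Decidable using (dec-true; dec-false)
open import Relation.Unary using (Pred; Decidable)
open import Relation.Unary.Properties using (∁?)
open import Data.Integer as ℤ using (-[1+_]; +≤+; +<+) renaming (+_ to pos)
import Data.Integer.Properties as ℤ
open import Data.Rational as ℚ using (mkℚ; 0ℚ; 1ℚ; ↥_; ↧ₙ_; toℚᵘ)
import Data.Rational.Properties as ℚ
import Data.Rational.Unnormalised as ℚᵘ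
import Data.Rational.Unnormalised.Properties as ℚᵘ
open import Function using (_∘_)
open import Data.List.Extrema.Nat using (argmax; argmax-all; f[xs]≤f[argmax])
open import Data.Nat.Solver using (module +-*-Solver)
open +-*-Solver using (solve; _:+_; _:*_; _:=_; con)
open import Level using (0ℓ)

module _ {X : Set} where

  ∈-─⁺ : ∀ {x z} {ys : List X} (p : x ∈ ys) → z ∈ ys → z ≢ x → z ∈ ys ─ p
  ∈-─⁺ (here refl) (here refl) z≢x = ⊥-elim (z≢x refl)
  ∈-─⁺ (here refl) (there q)   z≢x = q
  ∈-─⁺ (there p)   (here refl) z≢x = here refl
  ∈-─⁺ (there p)   (there q)   z≢x = there (∈-─⁺ p q z≢x)

  length-filter-∁ : ∀ {P : Pred X 0ℓ} (P? : Decidable P) xs →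
                    length (filter P? xs) + length (filter (∁? P?) xs) ≡ length xs
  length-filter-∁ P? [] = refl
  length-filter-∁ P? (x ∷ xs) with does (P? x)
  ... | true  = cong suc (length-filter-∁ P? xs)
  ... | false = trans (+-suc _ _) (cong suc (length-filter-∁ P? xs))

module _ {X Y : Set} where

  length-≤-injection : (xs : List X) (ys : List Y) (f : X → Y) → Unique xs →
    (∀ {x} → x ∈ xs → f x ∈ ys) →
    (∀ {x x′} → x ∈ xs → x′ ∈ xs → f x ≡ f x′ → x ≡ x′) → length xs ≤ length ys
  length-≤-injection [] ys f _ _ _ = z≤n
  length-≤-injection (x ∷ xs) ys f (x∉xs ∷ xs!) into inj =
    subst (suc (length xs) ≤_) (sym (length-removeAt′ ys _)) (s≤s rest)
    where
    fx∈ys = into (here refl)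
    rest : length xs ≤ length (ys ─ fx∈ys)
    rest = length-≤-injection xs (ys ─ fx∈ys) f xs!
      (λ q → ∈-─⁺ fx∈ys (into (there q))
               (λ e → All.lookup x∉xs q (inj (here refl) (there q) (sym e))))
      (λ q q′ → inj (there q) (there q′))

  length-concatMap-cong : {Z : Set} (f : X → List Y) (g : X → List Z) (xs : List X) →
    (∀ x → length (f x) ≡ length (g x)) → length (concatMap f xs) ≡ length (concatMap g xs)
  length-concatMap-cong f g [] eq = refl
  length-concatMap-cong f g (x ∷ xs) eq = begin
    length (f x ++ concatMap f xs)              ≡⟨ length-++ (f x) ⟩
    length (f x) + length (concatMap f xs)      ≡⟨ cong₂ _+_ (eq x) (length-concatMap-cong f g xs eq) ⟩
    length (g x) + length (concatMap g xs)      ≡⟨ length-++ (g x) ⟨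
    length (g x ++ concatMap g xs)              ∎
    where open ≡-Reasoning

  pairs : List X → (X → List Y) → List (X × Y)
  pairs xs f = concatMap (λ x → map (x ,_) (f x)) xs

  ∈-pairs⁺ : ∀ {xs f x y} → x ∈ xs → y ∈ f x → (x , y) ∈ pairs xs f
  ∈-pairs⁺ {x′ ∷ xs} {f} (here refl) q = ∈-++⁺ˡ (∈-map⁺ (x′ ,_) q)
  ∈-pairs⁺ {x′ ∷ xs} {f} (there p)   q = ∈-++⁺ʳ (map (x′ ,_) (f x′)) (∈-pairs⁺ p q)

  ∈-pairs⁻ : ∀ xs f {x y} → (x , y) ∈ pairs xs f → x ∈ xs × y ∈ f x
  ∈-pairs⁻ (x′ ∷ xs) f q with ∈-++⁻ (map (x′ ,_) (f x′)) q
  ... | inj₁ r with _ , r′ , refl ← ∈-map⁻ (x′ ,_) r = here refl , r′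
  ... | inj₂ r with p , q′ ← ∈-pairs⁻ xs f r = there p , q′

  pairs-unique : ∀ xs f → Unique xs → (∀ x → Unique (f x)) → Unique (pairs xs f)
  pairs-unique [] f _ _ = []
  pairs-unique (x ∷ xs) f (x∉xs ∷ xs!) f! =
    Unique.++⁺ (Unique.map⁺ (λ { refl → refl }) (f! x)) (pairs-unique xs f xs! f!)
      (λ (q , q′) → disjoint q q′)
    where
    disjoint : ∀ {v} → v ∈ map (x ,_) (f x) → v ∈ pairs xs f → ⊥
    disjoint q q′ with _ , _ , refl ← ∈-map⁻ (x ,_) q =
      All.lookup x∉xs (proj₁ (∈-pairs⁻ xs f q′)) refl

  length-pairs-∷ : ∀ x xs f → length (pairs (x ∷ xs) f) ≡ length (f x) + length (pairs xs f)
  length-pairs-∷ x xs f = trans (length-++ (map (x ,_) (f x))) (cong (_+ length (pairs xs f)) (length-map (x ,_) (f x)))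

  length-pairs-≤ : ∀ xs f B → (∀ {x} → x ∈ xs → length (f x) ≤ B) → length (pairs xs f) ≤ length xs * B
  length-pairs-≤ [] f B _ = z≤n
  length-pairs-≤ (x ∷ xs) f B bound rewrite length-pairs-∷ x xs f =
    +-mono-≤ (bound (here refl)) (length-pairs-≤ xs f B (bound ∘ there))

  length-pairs-≥ : ∀ xs f B → (∀ {x} → x ∈ xs → B ≤ length (f x)) → length xs * B ≤ length (pairs xs f)
  length-pairs-≥ [] f B _ = z≤n
  length-pairs-≥ (x ∷ xs) f B bound rewrite length-pairs-∷ x xs f =
    +-mono-≤ (bound (here refl)) (length-pairs-≥ xs f B (bound ∘ there))

-- A partition into parts ≤ K is encoded by its multiplicity vector, listing the
-- multiplicities of K, K - 1, …, 1 in this order.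
weight : ∀ {K} → Vec ℕ K → ℕ
weight [] = 0
weight {suc K} (j ∷ v) = j * suc K + weight v

mult : ∀ {K} → Vec ℕ K → ℕ → ℕ
mult [] a = 0
mult {suc K} (j ∷ v) a = if does (a ≟ suc K) then j else mult v a

update : ∀ {K} → Vec ℕ K → ℕ → (ℕ → ℕ) → Vec ℕ K
update [] a f = []
update {suc K} (j ∷ v) a f = if does (a ≟ suc K) then f j ∷ v else j ∷ update v a f

largestPart : ∀ {K} → Vec ℕ K → ℕ
largestPart [] = 0
largestPart {suc K} (zero ∷ v) = largestPart v
largestPart {suc K} (suc j ∷ v) = suc K

module _ {K : ℕ} where

  mult-here : ∀ j (v : Vec ℕ K) → mult (j ∷ v) (suc K) ≡ j
  mult-here j v rewrite dec-true (suc K ≟ suc K) refl = refl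

  mult-there : ∀ j (v : Vec ℕ K) {a} → a ≢ suc K → mult (j ∷ v) a ≡ mult v a
  mult-there j v {a} a≢ rewrite dec-false (a ≟ suc K) a≢ = refl

  update-here : ∀ j (v : Vec ℕ K) f → update (j ∷ v) (suc K) f ≡ f j ∷ v
  update-here j v f rewrite dec-true (suc K ≟ suc K) refl = refl

  update-there : ∀ j (v : Vec ℕ K) {a} f → a ≢ suc K → update (j ∷ v) a f ≡ j ∷ update v a f
  update-there j v {a} f a≢ rewrite dec-false (a ≟ suc K) a≢ = refl

mult-beyond : ∀ {K} (v : Vec ℕ K) {a} → K < a → mult v a ≡ 0
mult-beyond [] _ = refl
mult-beyond {suc K} (j ∷ v) {a} K<a =
  trans (mult-there j v (>⇒≢ K<a)) (mult-beyond v (<-trans (n<1+n K) K<a))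

mult-zero : ∀ {K} (v : Vec ℕ K) → mult v 0 ≡ 0
mult-zero [] = refl
mult-zero (j ∷ v) = mult-zero v

mult-ext : ∀ {K} (u v : Vec ℕ K) → (∀ a → mult u a ≡ mult v a) → u ≡ v
mult-ext [] [] _ = refl
mult-ext {suc K} (i ∷ u) (j ∷ v) eq = cong₂ _∷_ heads (mult-ext u v tails)
  where
  heads : i ≡ j
  heads = trans (sym (mult-here i u)) (trans (eq (suc K)) (mult-here j v))
  tails : ∀ a → mult u a ≡ mult v a
  tails a with a ≟ suc K
  ... | yes refl = trans (mult-beyond u (n<1+n K)) (sym (mult-beyond v (n<1+n K)))
  ... | no a≢ = trans (sym (mult-there i u a≢)) (trans (eq a) (mult-there j v a≢))

mult-update-same : ∀ {K} (v : Vec ℕ K) {a} f → 1 ≤ a → a ≤ K → mult (update v a f) a ≡ f (mult v a)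
mult-update-same [] f 1≤a a≤0 = ⊥-elim (<-irrefl refl (≤-trans 1≤a a≤0))
mult-update-same {suc K} (j ∷ v) {a} f 1≤a a≤1+K with a ≟ suc K
... | yes refl = begin
  mult (update (j ∷ v) (suc K) f) (suc K) ≡⟨ cong (λ u → mult u (suc K)) (update-here j v f) ⟩
  mult (f j ∷ v) (suc K)                  ≡⟨ mult-here (f j) v ⟩
  f j                                     ≡⟨ cong f (mult-here j v) ⟨
  f (mult (j ∷ v) (suc K))                ∎
  where open ≡-Reasoning
... | no a≢ = begin
  mult (update (j ∷ v) a f) a ≡⟨ cong (λ u → mult u a) (update-there j v f a≢) ⟩
  mult (j ∷ update v a f) a   ≡⟨ mult-there j (update v a f) a≢ ⟩
  mult (update v a f) a       ≡⟨ mult-update-same v f 1≤a (≤-pred (≤∧≢⇒< a≤1+K a≢)) ⟩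
  f (mult v a)                ≡⟨ cong f (mult-there j v a≢) ⟨
  f (mult (j ∷ v) a)          ∎
  where open ≡-Reasoning

mult-update-other : ∀ {K} (v : Vec ℕ K) {a b} f → b ≢ a → mult (update v a f) b ≡ mult v b
mult-update-other [] f _ = refl
mult-update-other {suc K} (j ∷ v) {a} {b} f b≢a with a ≟ suc K | b ≟ suc K
... | yes refl | _ = begin
  mult (update (j ∷ v) (suc K) f) b ≡⟨ cong (λ u → mult u b) (update-here j v f) ⟩
  mult (f j ∷ v) b                  ≡⟨ mult-there (f j) v b≢a ⟩
  mult v b                          ≡⟨ mult-there j v b≢a ⟨
  mult (j ∷ v) b                    ∎
  where open ≡-Reasoning
... | no a≢ | yes refl = begin
  mult (update (j ∷ v) a f) (suc K) ≡⟨ cong (λ u → mult u (suc K)) (update-there j v f a≢) ⟩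
  mult (j ∷ update v a f) (suc K)   ≡⟨ mult-here j (update v a f) ⟩
  j                                 ≡⟨ mult-here j v ⟨
  mult (j ∷ v) (suc K)              ∎
  where open ≡-Reasoning
... | no a≢ | no b≢ = begin
  mult (update (j ∷ v) a f) b ≡⟨ cong (λ u → mult u b) (update-there j v f a≢) ⟩
  mult (j ∷ update v a f) b   ≡⟨ mult-there j (update v a f) b≢ ⟩
  mult (update v a f) b       ≡⟨ mult-update-other v f b≢a ⟩
  mult v b                    ≡⟨ mult-there j v b≢ ⟨
  mult (j ∷ v) b              ∎
  where open ≡-Reasoning

update-injective : ∀ {K} (v v′ : Vec ℕ K) {a} f → 1 ≤ a → a ≤ K →
  (f (mult v a) ≡ f (mult v′ a) → mult v a ≡ mult v′ a) → update v a f ≡ update v′ a f → v ≡ v′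
update-injective v v′ {a} f 1≤a a≤K f-cancel eq = mult-ext v v′ same
  where
  same : ∀ b → mult v b ≡ mult v′ b
  same b with b ≟ a
  ... | yes refl = f-cancel (begin
    f (mult v a)          ≡⟨ mult-update-same v f 1≤a a≤K ⟨
    mult (update v a f) a ≡⟨ cong (λ u → mult u a) eq ⟩
    mult (update v′ a f) a ≡⟨ mult-update-same v′ f 1≤a a≤K ⟩
    f (mult v′ a)         ∎)
    where open ≡-Reasoning
  ... | no b≢a = begin
    mult v b               ≡⟨ mult-update-other v f b≢a ⟨
    mult (update v a f) b  ≡⟨ cong (λ u → mult u b) eq ⟩
    mult (update v′ a f) b ≡⟨ mult-update-other v′ f b≢a ⟩
    mult v′ b              ∎
    where open ≡-Reasoning

weight-update : ∀ {K} (v : Vec ℕ K) {a} f → a ≤ K →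
                weight (update v a f) + a * mult v a ≡ weight v + a * f (mult v a)
weight-update [] f z≤n = refl
weight-update {suc K} (j ∷ v) {a} f a≤1+K with a ≟ suc K
... | yes refl = begin
  weight (update (j ∷ v) (suc K) f) + suc K * mult (j ∷ v) (suc K)
    ≡⟨ cong₂ (λ u m → weight u + suc K * m) (update-here j v f) (mult-here j v) ⟩
  f j * suc K + weight v + suc K * j
    ≡⟨ swap (f j) j (suc K) (weight v) ⟩
  j * suc K + weight v + suc K * f j
    ≡⟨ cong (λ m → j * suc K + weight v + suc K * f m) (mult-here j v) ⟨
  weight (j ∷ v) + suc K * f (mult (j ∷ v) (suc K)) ∎
  where
  open ≡-Reasoning
  swap : ∀ x y k w → x * k + w + k * y ≡ y * k + w + k * x
  swap = solve 4 (λ x y k w → x :* k :+ w :+ k :* y := y :* k :+ w :+ k :* x) refl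
... | no a≢ = begin
  weight (update (j ∷ v) a f) + a * mult (j ∷ v) a
    ≡⟨ cong₂ (λ u m → weight u + a * m) (update-there j v f a≢) (mult-there j v a≢) ⟩
  j * suc K + weight (update v a f) + a * mult v a
    ≡⟨ +-assoc (j * suc K) _ _ ⟩
  j * suc K + (weight (update v a f) + a * mult v a)
    ≡⟨ cong (j * suc K +_) (weight-update v f (≤-pred (≤∧≢⇒< a≤1+K a≢))) ⟩
  j * suc K + (weight v + a * f (mult v a))
    ≡⟨ +-assoc (j * suc K) _ _ ⟨
  j * suc K + weight v + a * f (mult v a)
    ≡⟨ cong (λ m → j * suc K + weight v + a * f m) (mult-there j v a≢) ⟨
  weight (j ∷ v) + a * f (mult (j ∷ v) a) ∎
  where open ≡-Reasoning

weight-remove : ∀ {K} (v : Vec ℕ K) {a} s → s ≤ mult v a → a ≤ K →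
                weight (update v a (_∸ s)) + a * s ≡ weight v
weight-remove v {a} s s≤m a≤K = +-cancelʳ-≡ (a * (mult v a ∸ s)) _ _ (begin
  weight (update v a (_∸ s)) + a * s + a * (mult v a ∸ s)   ≡⟨ +-assoc (weight (update v a (_∸ s))) _ _ ⟩
  weight (update v a (_∸ s)) + (a * s + a * (mult v a ∸ s)) ≡⟨ cong (weight (update v a (_∸ s)) +_) (*-distribˡ-+ a s _) ⟨
  weight (update v a (_∸ s)) + a * (s + (mult v a ∸ s))     ≡⟨ cong (λ m → weight (update v a (_∸ s)) + a * m) (m+[n∸m]≡n s≤m) ⟩
  weight (update v a (_∸ s)) + a * mult v a                 ≡⟨ weight-update v (_∸ s) a≤K ⟩
  weight v + a * (mult v a ∸ s)                             ∎)
  where open ≡-Reasoning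

weight-add : ∀ {K} (v : Vec ℕ K) {a} → a ≤ K → weight (update v a suc) ≡ weight v + a
weight-add v {a} a≤K = +-cancelʳ-≡ (a * mult v a) _ _ (begin
  weight (update v a suc) + a * mult v a ≡⟨ weight-update v suc a≤K ⟩
  weight v + a * suc (mult v a)          ≡⟨ cong (weight v +_) (*-suc a (mult v a)) ⟩
  weight v + (a + a * mult v a)          ≡⟨ +-assoc (weight v) a _ ⟨
  weight v + a + a * mult v a            ∎)
  where open ≡-Reasoning

largestPart-≤ : ∀ {K} (v : Vec ℕ K) → largestPart v ≤ K
largestPart-≤ [] = z≤n
largestPart-≤ (zero ∷ v) = m≤n⇒m≤1+n (largestPart-≤ v)
largestPart-≤ (suc j ∷ v) = ≤-refl

mult-largestPart : ∀ {K} (v : Vec ℕ K) → 0 < largestPart v → mult v (largestPart v) ≢ 0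
mult-largestPart (zero ∷ v) 0<ℓ =
  subst (_≢ 0) (sym (mult-there 0 v (<⇒≢ (s≤s (largestPart-≤ v))))) (mult-largestPart v 0<ℓ)
mult-largestPart (suc j ∷ v) _ = subst (_≢ 0) (sym (mult-here (suc j) v)) λ ()

mult-above-largestPart : ∀ {K} (v : Vec ℕ K) {a} → largestPart v < a → mult v a ≡ 0
mult-above-largestPart [] _ = refl
mult-above-largestPart {suc K} (zero ∷ v) {a} ℓ<a with a ≟ suc K
... | yes refl = mult-here 0 v
... | no a≢ = trans (mult-there 0 v a≢) (mult-above-largestPart v ℓ<a)
mult-above-largestPart (suc j ∷ v) ℓ<a = mult-beyond (suc j ∷ v) ℓ<a

mult-tail-≤ : ∀ {K} j (v : Vec ℕ K) B → (∀ a → mult (j ∷ v) a ≤ B) → ∀ a → mult v a ≤ B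
mult-tail-≤ {K} j v B bound a with a ≟ suc K
... | yes refl = subst (_≤ B) (sym (mult-beyond v (n<1+n K))) z≤n
... | no a≢ = subst (_≤ B) (mult-there j v a≢) (bound a)

weight-≤ : ∀ {K} (v : Vec ℕ K) B → (∀ a → mult v a ≤ B) → weight v ≤ B * (largestPart v * largestPart v)
weight-≤ [] B _ = z≤n
weight-≤ (zero ∷ v) B bound = weight-≤ v B (mult-tail-≤ 0 v B bound)
weight-≤ {suc K} (suc j ∷ v) B bound = begin
  suc j * suc K + weight v             ≤⟨ +-mono-≤ (*-monoˡ-≤ (suc K) head) tail ⟩
  B * suc K + B * (K * K)              ≡⟨ *-distribˡ-+ B (suc K) (K * K) ⟨
  B * (suc K + K * K)                  ≤⟨ *-monoʳ-≤ B (+-monoʳ-≤ (suc K) (*-monoʳ-≤ K (n≤1+n K))) ⟩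
  B * (suc K * suc K)                  ∎
  where
  open ≤-Reasoning
  head : suc j ≤ B
  head = subst (_≤ B) (mult-here (suc j) v) (bound (suc K))
  tail : weight v ≤ B * (K * K)
  tail = ≤-trans (weight-≤ v B (mult-tail-≤ (suc j) v B bound)) (*-monoʳ-≤ B (*-mono-≤ (largestPart-≤ v) (largestPart-≤ v)))

PartsIn : ∀ {K} → Subset → Vec ℕ K → Set
PartsIn A v = ∀ a → mult v a ≢ 0 → A a ≡ true

cons : ∀ {K} → ℕ × Vec ℕ K → Vec ℕ (suc K)
cons (j , v) = j ∷ v

headFits : Subset → (K n j : ℕ) → Bool
headFits A K n j = (j * suc K ≤ᵇ n) ∧ ((j ≡ᵇ 0) ∨ A (suc K))

-- Mirrors the recursion of `parts`, with the multiplicity j of K as head.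
partitionVectors : Subset → (K n : ℕ) → List (Vec ℕ K)
partitionVectorsWithHead : Subset → (K n j : ℕ) → List (Vec ℕ K)
partitionVectors A zero zero = [] ∷ []
partitionVectors A zero (suc n) = []
partitionVectors A (suc K) n = map cons (pairs (upTo (suc n)) (partitionVectorsWithHead A K n))
partitionVectorsWithHead A K n j = if headFits A K n j then partitionVectors A K (n ∸ j * suc K) else []

private
  -- The guard of the recursive clause of `parts` is built from helpers local to
  -- its definition; unification names it, and it is then identified with `headFits`.
  partsGuard : Σ (Subset → ℕ → ℕ → ℕ → Bool) λ g → ∀ A K n →
    parts A (suc K) n ≡
      concatMap (λ j → if g A K n j then map (replicate j (suc K) ++_) (parts A K (n ∸ j * suc K)) else [])
                (upTo (suc n))
  partsGuard = _ , λ A K n → refl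

  partsGuard≡headFits : ∀ A K n j → proj₁ partsGuard A K n j ≡ headFits A K n j
  partsGuard≡headFits A K n j with j * suc K ≤ᵇ n
  partsGuard≡headFits A K n zero    | true  = refl
  partsGuard≡headFits A K n (suc j) | true  = refl
  partsGuard≡headFits A K n j       | false = refl

length-parts : ∀ A K n → length (parts A K n) ≡ length (partitionVectors A K n)
length-parts A zero zero = refl
length-parts A zero (suc n) = refl
length-parts A (suc K) n = begin
  length (parts A (suc K) n)
    ≡⟨ cong length (proj₂ partsGuard A K n) ⟩
  length (concatMap byHead (upTo (suc n)))
    ≡⟨ length-concatMap-cong byHead (λ j → map (j ,_) (partitionVectorsWithHead A K n j)) (upTo (suc n)) length-byHead ⟩
  length (pairs (upTo (suc n)) (partitionVectorsWithHead A K n))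
    ≡⟨ length-map cons (pairs (upTo (suc n)) (partitionVectorsWithHead A K n)) ⟨
  length (partitionVectors A (suc K) n) ∎
  where
  open ≡-Reasoning
  byHead : ℕ → List (List ℕ)
  byHead j = if proj₁ partsGuard A K n j then map (replicate j (suc K) ++_) (parts A K (n ∸ j * suc K)) else []
  length-byHead : ∀ j → length (byHead j) ≡ length (map (j ,_) (partitionVectorsWithHead A K n j))
  length-byHead j rewrite partsGuard≡headFits A K n j with headFits A K n j
  ... | false = refl
  ... | true = trans (length-map _ (parts A K _)) (trans (length-parts A K _) (sym (length-map _ (partitionVectors A K _))))

module _ {A : Subset} where

  PartsIn-∷⁺ : ∀ {K} j (v : Vec ℕ K) → ((j ≡ᵇ 0) ∨ A (suc K)) ≡ true → PartsIn A v → PartsIn A (j ∷ v)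
  PartsIn-∷⁺ {K} j v head tail a m≢0 with a ≟ suc K
  PartsIn-∷⁺ zero v head tail a m≢0 | yes refl = ⊥-elim (m≢0 (mult-here 0 v))
  PartsIn-∷⁺ (suc j) v head tail a m≢0 | yes refl = head
  ... | no a≢ = tail a (subst (_≢ 0) (mult-there j v a≢) m≢0)

  PartsIn-head : ∀ {K} j (v : Vec ℕ K) → PartsIn A (j ∷ v) → ((j ≡ᵇ 0) ∨ A (suc K)) ≡ true
  PartsIn-head zero v _ = refl
  PartsIn-head {K} (suc j) v parts = parts (suc K) (subst (_≢ 0) (sym (mult-here (suc j) v)) λ ())

  PartsIn-tail : ∀ {K} j (v : Vec ℕ K) → PartsIn A (j ∷ v) → PartsIn A v
  PartsIn-tail {K} j v parts a m≢0 with a ≟ suc K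
  ... | yes refl = ⊥-elim (m≢0 (mult-beyond v (n<1+n K)))
  ... | no a≢ = parts a (subst (_≢ 0) (sym (mult-there j v a≢)) m≢0)

  PartsIn-update : ∀ {K} (v : Vec ℕ K) {a} f → 1 ≤ a → a ≤ K → PartsIn A v →
                   (f (mult v a) ≢ 0 → A a ≡ true) → PartsIn A (update v a f)
  PartsIn-update v {a} f 1≤a a≤K parts new b m≢0 with b ≟ a
  ... | yes refl = new (subst (_≢ 0) (mult-update-same v f 1≤a a≤K) m≢0)
  ... | no b≢a = parts b (subst (_≢ 0) (mult-update-other v f b≢a) m≢0)

  partitionVectors-sound : ∀ K n {v} → v ∈ partitionVectors A K n → weight v ≡ n × PartsIn A v
  partitionVectors-sound zero zero (here refl) = refl , λ _ m≢0 → ⊥-elim (m≢0 refl)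
  partitionVectors-sound (suc K) n q
    with (j , w) , jw∈ , refl ← ∈-map⁻ cons q
    with _ , w∈ ← ∈-pairs⁻ (upTo (suc n)) (partitionVectorsWithHead A K n) jw∈
    with j * suc K ≤ᵇ n in fits | (j ≡ᵇ 0) ∨ A (suc K) in allowed
  ... | true | true =
    let (weight-w , parts-w) = partitionVectors-sound K (n ∸ j * suc K) w∈
    in trans (cong (j * suc K +_) weight-w) (m+[n∸m]≡n (≤ᵇ⇒≤ (j * suc K) n (Equivalence.from T-≡ fits)))
       , PartsIn-∷⁺ j w allowed parts-w

  partitionVectors-complete : ∀ K (v : Vec ℕ K) → PartsIn A v → v ∈ partitionVectors A K (weight v)
  partitionVectors-complete zero [] _ = here refl
  partitionVectors-complete (suc K) (j ∷ v) parts = ∈-map⁺ cons (∈-pairs⁺ j∈ v∈)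
    where
    n = j * suc K + weight v
    fits : j * suc K ≤ n
    fits = m≤m+n (j * suc K) (weight v)
    j∈ : j ∈ upTo (suc n)
    j∈ = ∈-upTo⁺ (s≤s (≤-trans (m≤m*n j (suc K)) fits))
    headFits-true : headFits A K n j ≡ true
    headFits-true = cong₂ _∧_ (Equivalence.to T-≡ (≤⇒≤ᵇ fits)) (PartsIn-head j v parts)
    v∈ : v ∈ partitionVectorsWithHead A K n j
    v∈ = subst (λ b → v ∈ (if b then partitionVectors A K (n ∸ j * suc K) else [])) (sym headFits-true)
           (subst (λ m → v ∈ partitionVectors A K m) (sym (m+n∸m≡n (j * suc K) (weight v)))
              (partitionVectors-complete K v (PartsIn-tail j v parts)))

  partitionVectors-unique : ∀ K n → Unique (partitionVectors A K n)
  partitionVectors-unique zero zero = All.[] ∷ []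
  partitionVectors-unique zero (suc n) = []
  partitionVectors-unique (suc K) n =
    Unique.map⁺ cons-injective (pairs-unique (upTo (suc n)) (partitionVectorsWithHead A K n) (Unique.upTo⁺ (suc n)) byHead)
    where
    cons-injective : ∀ {x y} → cons {K} x ≡ cons y → x ≡ y
    cons-injective {_ , _} {_ , _} eq with refl , refl ← ∷-injective eq = refl
    byHead : ∀ j → Unique (partitionVectorsWithHead A K n j)
    byHead j with headFits A K n j
    ... | true = partitionVectors-unique K (n ∸ j * suc K)
    ... | false = []

  partitionVectorsWithHead-tooHeavy : ∀ K m j → m < j * suc K → partitionVectorsWithHead A K m j ≡ []
  partitionVectorsWithHead-tooHeavy K m j m<j*k with j * suc K ≤ᵇ m in fits
  ... | false = refl
  ... | true = ⊥-elim (<⇒≱ m<j*k (≤ᵇ⇒≤ (j * suc K) m (Equivalence.from T-≡ fits)))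

  length-partitionVectors-suc : ∀ K m → m ≤ K → length (partitionVectors A (suc K) m) ≡ length (partitionVectors A K m)
  length-partitionVectors-suc K m m≤K = begin
    length (map cons (pairs (upTo (suc m)) (partitionVectorsWithHead A K m)))
      ≡⟨ length-map cons (pairs (upTo (suc m)) (partitionVectorsWithHead A K m)) ⟩
    length (pairs (0 ∷ applyUpTo suc m) (partitionVectorsWithHead A K m))
      ≡⟨ length-pairs-∷ 0 (applyUpTo suc m) (partitionVectorsWithHead A K m) ⟩
    length (partitionVectors A K m) + length (pairs (applyUpTo suc m) (partitionVectorsWithHead A K m))
      ≡⟨ cong (length (partitionVectors A K m) +_) (n≤0⇒n≡0 positiveHeads) ⟩
    length (partitionVectors A K m) + 0
      ≡⟨ +-identityʳ _ ⟩
    length (partitionVectors A K m) ∎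
    where
    open ≡-Reasoning
    noPositiveHead : ∀ {j} → j ∈ applyUpTo suc m → length (partitionVectorsWithHead A K m j) ≤ 0
    noPositiveHead q with i , _ , refl ← ∈-applyUpTo⁻ suc q =
      ≤-reflexive (cong length (partitionVectorsWithHead-tooHeavy K m (suc i)
        (≤-trans (s≤s m≤K) (m≤n*m (suc K) (suc i)))))
    positiveHeads : length (pairs (applyUpTo suc m) (partitionVectorsWithHead A K m)) ≤ 0
    positiveHeads = ≤-trans (length-pairs-≤ _ _ 0 noPositiveHead) (≤-reflexive (*-zeroʳ (length (applyUpTo suc m))))

  length-partitionVectors : ∀ K n → n ≤ K → length (partitionVectors A K n) ≡ p A n
  length-partitionVectors K n n≤K with m≤n⇒m<n∨m≡n n≤K
  ... | inj₂ refl = sym (length-parts A n n)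
  length-partitionVectors (suc K) n _ | inj₁ n<1+K =
    trans (length-partitionVectors-suc K n (≤-pred n<1+K)) (length-partitionVectors K n (≤-pred n<1+K))

  partitionsBelow : ∀ N → List (Vec ℕ N)
  partitionsBelow N = concatMap (partitionVectors A N) (upTo N)

  ∈-partitionsBelow : ∀ {N} (v : Vec ℕ N) → PartsIn A v → weight v < N → v ∈ partitionsBelow N
  ∈-partitionsBelow {N} v parts v<N =
    ∈-concatMap⁺ (partitionVectors A N) (Any.map (λ { refl → partitionVectors-complete N v parts }) (∈-upTo⁺ v<N))

  length-partitionsBelow : ∀ n → length (partitionsBelow (suc n)) ≡ S A n
  length-partitionsBelow n = go n ≤-refl
    where
    go : ∀ m → m ≤ n → length (concatMap (partitionVectors A (suc n)) (upTo (suc m))) ≡ S A m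
    go zero _ = trans (length-++ (partitionVectors A (suc n) 0)) (trans (+-identityʳ _) (length-partitionVectors (suc n) 0 z≤n))
    go (suc m) m<n = begin
      length (concatMap (partitionVectors A (suc n)) (upTo (suc (suc m))))
        ≡⟨ cong (length ∘ concatMap (partitionVectors A (suc n))) (upTo-∷ʳ (suc m)) ⟨
      length (concatMap (partitionVectors A (suc n)) (upTo (suc m) ∷ʳ suc m))
        ≡⟨ cong length (concatMap-++ (partitionVectors A (suc n)) (upTo (suc m)) (suc m ∷ [])) ⟩
      length (concatMap (partitionVectors A (suc n)) (upTo (suc m)) ++ (partitionVectors A (suc n) (suc m) ++ []))
        ≡⟨ length-++ (concatMap (partitionVectors A (suc n)) (upTo (suc m))) ⟩
      length (concatMap (partitionVectors A (suc n)) (upTo (suc m))) + length (partitionVectors A (suc n) (suc m) ++ [])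
        ≡⟨ cong₂ _+_ (go m (<⇒≤ m<n)) (trans (length-++ (partitionVectors A (suc n) (suc m))) (+-identityʳ _)) ⟩
      S A m + length (partitionVectors A (suc n) (suc m))
        ≡⟨ cong (S A m +_) (length-partitionVectors (suc n) (suc m) (m≤n⇒m≤1+n m<n)) ⟩
      S A (suc m) ∎
      where open ≡-Reasoning

∈-applyUpTo-suc⁺ : ∀ {a k} → 1 ≤ a → a ≤ k → a ∈ applyUpTo suc k
∈-applyUpTo-suc⁺ {suc a} (s≤s _) a<k = ∈-applyUpTo⁺ suc a<k

AllowedUpTo : Subset → ℕ → ℕ → Set
AllowedUpTo A k a = 1 ≤ a × a ≤ k × A a ≡ true

allowedUpTo : Subset → ℕ → List ℕ
allowedUpTo A k = filter (λ a → A a Bool.≟ true) (applyUpTo suc k)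

module _ {A : Subset} {k : ℕ} where

  ∈-allowedUpTo⁺ : ∀ {a} → AllowedUpTo A k a → a ∈ allowedUpTo A k
  ∈-allowedUpTo⁺ (1≤a , a≤k , a∈A) = ∈-filter⁺ (λ a → A a Bool.≟ true) (∈-applyUpTo-suc⁺ 1≤a a≤k) a∈A

  ∈-allowedUpTo⁻ : ∀ {a} → a ∈ allowedUpTo A k → AllowedUpTo A k a
  ∈-allowedUpTo⁻ q with q′ , a∈A ← ∈-filter⁻ (λ a → A a Bool.≟ true) {xs = applyUpTo suc k} q
                   with i , i<k , refl ← ∈-applyUpTo⁻ suc q′ = s≤s z≤n , i<k , a∈A

  allowedUpTo-unique : Unique (allowedUpTo A k)
  allowedUpTo-unique = Unique.filter⁺ (λ a → A a Bool.≟ true)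
    (Unique.applyUpTo⁺₁ suc k (λ i<j _ → <⇒≢ (s≤s i<j)))

removal-∈-partitionsBelow : ∀ {A N} (v : Vec ℕ N) {a} s → PartsIn A v → weight v ≡ N →
                    1 ≤ a → a ≤ N → 1 ≤ s → s ≤ mult v a → update v a (_∸ s) ∈ partitionsBelow {A} N
removal-∈-partitionsBelow {A} {N} v {a} s parts weight-v 1≤a a≤N 1≤s s≤m =
  ∈-partitionsBelow (update v a (_∸ s)) (PartsIn-update v (_∸ s) 1≤a a≤N parts (λ _ → a∈A)) lighter
  where
  a∈A : A a ≡ true
  a∈A = parts a (n>0⇒n≢0 (≤-trans 1≤s s≤m))
  lighter : weight (update v a (_∸ s)) < N
  lighter = begin-strict
    weight (update v a (_∸ s))         <⟨ m<m+n _ (*-mono-≤ 1≤a 1≤s) ⟩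
    weight (update v a (_∸ s)) + a * s ≡⟨ trans (weight-remove v s s≤m a≤N) weight-v ⟩
    N                                  ∎
    where open ≤-Reasoning

module Injections (A : Subset) {N : ℕ} (k M : ℕ) (k≤N : k ≤ N) where

  partitions : List (Vec ℕ N)
  partitions = partitionVectors A N N

  absent? : (v : Vec ℕ N) → Decidable (λ a → mult v a ≡ 0)
  absent? v a = mult v a ≟ 0

  missing present : Vec ℕ N → List ℕ
  missing v = filter (absent? v) (allowedUpTo A k)
  present v = filter (∁? (absent? v)) (allowedUpTo A k)

  rich? : Decidable (λ v → M ≤ length (present v))
  rich? v = M ≤? length (present v)

  big? : Decidable (λ (v : Vec ℕ N) → k < largestPart v)
  big? v = k <? largestPart v

  ∈-present⁻ : ∀ {v a} → a ∈ present v → AllowedUpTo A k a × mult v a ≢ 0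
  ∈-present⁻ {v} q with q′ , m≢0 ← ∈-filter⁻ (∁? (absent? v)) {xs = allowedUpTo A k} q =
    ∈-allowedUpTo⁻ q′ , m≢0

  ∈-present⁺ : ∀ {v a} → AllowedUpTo A k a → mult v a ≢ 0 → a ∈ present v
  ∈-present⁺ {v} allowed m≢0 = ∈-filter⁺ (∁? (absent? v)) (∈-allowedUpTo⁺ allowed) m≢0

  ∈-missing⁻ : ∀ {v a} → a ∈ missing v → AllowedUpTo A k a
  ∈-missing⁻ {v} q = ∈-allowedUpTo⁻ (proj₁ (∈-filter⁻ (absent? v) {xs = allowedUpTo A k} q))

  present-unique : ∀ v → Unique (present v)
  present-unique v = Unique.filter⁺ (∁? (absent? v)) (allowedUpTo-unique {A} {k})

  missing-unique : ∀ v → Unique (missing v)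
  missing-unique v = Unique.filter⁺ (absent? v) (allowedUpTo-unique {A} {k})

  rich poor : List (Vec ℕ N)
  rich = filter rich? partitions
  poor = filter (∁? rich?) partitions

  count-rich : length rich * M ≤ length (partitionsBelow {A} N)
  count-rich = begin
    length rich * M             ≤⟨ length-pairs-≥ rich present M (λ q → proj₂ (∈-filter⁻ rich? {xs = partitions} q)) ⟩
    length (pairs rich present) ≤⟨ length-≤-injection (pairs rich present) (partitionsBelow N) dropOne unique into injective ⟩
    length (partitionsBelow N)  ∎
    where
    open ≤-Reasoning
    dropOne : Vec ℕ N × ℕ → Vec ℕ N
    dropOne (v , a) = update v a (_∸ 1)
    facts : ∀ {v a} → (v , a) ∈ pairs rich present → (weight v ≡ N × PartsIn A v) × AllowedUpTo A k a × mult v a ≢ 0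
    facts {v} q with v∈ , a∈ ← ∈-pairs⁻ rich present q =
      partitionVectors-sound N N (proj₁ (∈-filter⁻ rich? {xs = partitions} v∈)) , ∈-present⁻ {v} a∈
    unique : Unique (pairs rich present)
    unique = pairs-unique rich present (Unique.filter⁺ rich? (partitionVectors-unique N N)) present-unique
    into : ∀ {p} → p ∈ pairs rich present → dropOne p ∈ partitionsBelow N
    into {v , a} q with (weight-v , parts) , (1≤a , a≤k , _) , m≢0 ← facts q =
      removal-∈-partitionsBelow v 1 parts weight-v 1≤a (≤-trans a≤k k≤N) ≤-refl (n≢0⇒n>0 m≢0)
    dropOne-weight : ∀ {v a} → (v , a) ∈ pairs rich present → weight (dropOne (v , a)) + a ≡ N
    dropOne-weight {v} {a} q with (weight-v , _) , (_ , a≤k , _) , m≢0 ← facts q =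
      trans (cong (weight (dropOne (v , a)) +_) (sym (*-identityʳ a)))
            (trans (weight-remove v 1 (n≢0⇒n>0 m≢0) (≤-trans a≤k k≤N)) weight-v)
    injective : ∀ {p p′} → p ∈ pairs rich present → p′ ∈ pairs rich present → dropOne p ≡ dropOne p′ → p ≡ p′
    injective {v , a} {v′ , a′} q q′ eq
      with refl ← +-cancelˡ-≡ (weight (dropOne (v , a))) a a′
                    (trans (dropOne-weight q) (trans (sym (dropOne-weight q′)) (cong (λ u → weight u + a′) (sym eq))))
      with _ , (1≤a , a≤k , _) , m≢0 ← facts q | _ , _ , m′≢0 ← facts q′ =
      cong (_, a) (update-injective v v′ (_∸ 1) 1≤a (≤-trans a≤k k≤N)
                     (∸-cancelʳ-≡ (n≢0⇒n>0 m≢0) (n≢0⇒n>0 m′≢0)) eq)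

  ∈-poor⁻ : ∀ {v} → v ∈ poor → (weight v ≡ N × PartsIn A v) × length (present v) < M
  ∈-poor⁻ q with v∈ , not-rich ← ∈-filter⁻ (∁? rich?) {xs = partitions} q =
    partitionVectors-sound N N v∈ , ≰⇒> not-rich

  poor-unique : Unique poor
  poor-unique = Unique.filter⁺ (∁? rich?) (partitionVectors-unique N N)

  poorBig poorSmall : List (Vec ℕ N)
  poorBig = filter big? poor
  poorSmall = filter (∁? big?) poor

  record SwapData (v : Vec ℕ N) (a : ℕ) : Set where
    field
      weight-v : weight v ≡ N
      parts-v : PartsIn A v
      few : length (present v) < M
      big : k < largestPart v
      a-allowed : AllowedUpTo A k a

  swapData : ∀ {v a} → (v , a) ∈ pairs poorBig missing → SwapData v a
  swapData {v} q
    with v∈ , a∈ ← ∈-pairs⁻ poorBig missing q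
    with v∈poor , big ← ∈-filter⁻ big? {xs = poor} v∈
    with (weight-v , parts-v) , few ← ∈-poor⁻ v∈poor
    = record { weight-v = weight-v ; parts-v = parts-v ; few = few ; big = big
             ; a-allowed = ∈-missing⁻ {v} a∈ }

  -- A poor partition with a part b > k loses one copy of b and gains one copy
  -- of a missing allowed part a; b is recovered from the weight of the result.
  module Swap {v : Vec ℕ N} {a : ℕ} (d : SwapData v a) where
    open SwapData d

    b : ℕ
    b = largestPart v

    0<b : 0 < b
    0<b = ≤-trans (s≤s z≤n) big

    b≤N : b ≤ N
    b≤N = largestPart-≤ v

    a≤N : a ≤ N
    a≤N = ≤-trans (proj₁ (proj₂ a-allowed)) k≤N

    a<b : a < b
    a<b = ≤-trans (s≤s (proj₁ (proj₂ a-allowed))) big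

    shrunk swapped : Vec ℕ N
    shrunk = update v b (_∸ 1)
    swapped = update shrunk a suc

    swapped-weight : weight swapped + b ≡ N + a
    swapped-weight = begin
      weight swapped + b         ≡⟨ cong (_+ b) (weight-add shrunk a≤N) ⟩
      weight shrunk + a + b      ≡⟨ exchange (weight shrunk) a b ⟩
      weight shrunk + b * 1 + a  ≡⟨ cong (_+ a) (trans (weight-remove v 1 (n≢0⇒n>0 (mult-largestPart v 0<b)) b≤N) weight-v) ⟩
      N + a                      ∎
      where
      open ≡-Reasoning
      exchange : ∀ w a b → w + a + b ≡ w + b * 1 + a
      exchange = solve 3 (λ w a b → w :+ a :+ b := w :+ b :* con 1 :+ a) refl

    swapped-lighter : weight swapped < N
    swapped-lighter = +-cancelʳ-< b (weight swapped) N (begin-strict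
      weight swapped + b ≡⟨ swapped-weight ⟩
      N + a              <⟨ +-monoʳ-< N a<b ⟩
      N + b              ∎)
      where open ≤-Reasoning

    swapped-parts : PartsIn A swapped
    swapped-parts =
      PartsIn-update shrunk suc (proj₁ a-allowed) a≤N
        (PartsIn-update v (_∸ 1) 0<b b≤N parts-v (λ _ → parts-v b (mult-largestPart v 0<b)))
        (λ _ → proj₂ (proj₂ a-allowed))

    swapped-has-a : mult swapped a ≢ 0
    swapped-has-a = subst (_≢ 0) (sym (mult-update-same shrunk suc (proj₁ a-allowed) a≤N)) λ ()

    swapped-elsewhere : ∀ x → x ≢ a → x ≢ b → mult swapped x ≡ mult v x
    swapped-elsewhere x x≢a x≢b = trans (mult-update-other shrunk suc x≢a) (mult-update-other v (_∸ 1) x≢b)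

    swapped-few : length (present swapped) ≤ M
    swapped-few = ≤-trans
      (length-≤-injection (present swapped) (a ∷ present v) (λ x → x) (present-unique swapped) into (λ _ _ e → e))
      few
      where
      into : ∀ {x} → x ∈ present swapped → x ∈ a ∷ present v
      into {x} q with x ≟ a | ∈-present⁻ {swapped} q
      ... | yes refl | _ = here refl
      ... | no x≢a | x-allowed@(_ , x≤k , _) , m≢0 =
        there (∈-present⁺ {v} x-allowed (subst (_≢ 0) (swapped-elsewhere x x≢a (<⇒≢ (<-≤-trans (s≤s x≤k) big))) m≢0))

  swap-injective : ∀ {v v′ a} (d : SwapData v a) (d′ : SwapData v′ a) → Swap.swapped d ≡ Swap.swapped d′ → v ≡ v′
  swap-injective {v} {v′} {a} d d′ swapped≡ =
    update-injective v v′ (_∸ 1) (0<b d) (b≤N d) (∸-cancelʳ-≡ (n≢0⇒n>0 (mult-largestPart v (0<b d))) (n≢0⇒n>0 m′≢0)) shrunk≡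
    where
    open Swap
    b≡ : b d ≡ b d′
    b≡ = +-cancelˡ-≡ (weight (swapped d)) _ _
           (trans (swapped-weight d) (trans (sym (swapped-weight d′)) (cong (λ u → weight u + b d′) (sym swapped≡))))
    m′≢0 : mult v′ (b d) ≢ 0
    m′≢0 = subst (λ c → mult v′ c ≢ 0) (sym b≡) (mult-largestPart v′ (0<b d′))
    shrunk≡ : shrunk d ≡ update v′ (b d) (_∸ 1)
    shrunk≡ = trans (update-injective (shrunk d) (shrunk d′) suc (proj₁ (SwapData.a-allowed d)) (a≤N d) suc-injective swapped≡)
                    (cong (λ c → update v′ c (_∸ 1)) (sym b≡))

  few? : Decidable (λ ν → length (present ν) ≤ M)
  few? ν = length (present ν) ≤? M

  fewPresent : List (Vec ℕ N)
  fewPresent = filter few? (partitionsBelow {A} N)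

  count-poorBig : length poorBig * (length (allowedUpTo A k) ∸ M) ≤ length (partitionsBelow {A} N) * M
  count-poorBig = begin
    length poorBig * (length (allowedUpTo A k) ∸ M)
      ≤⟨ length-pairs-≥ poorBig missing _ many-missing ⟩
    length (pairs poorBig missing)
      ≤⟨ length-≤-injection (pairs poorBig missing) (pairs fewPresent present) swap unique into injective ⟩
    length (pairs fewPresent present)
      ≤⟨ length-pairs-≤ fewPresent present M (λ q → proj₂ (∈-filter⁻ few? {xs = partitionsBelow N} q)) ⟩
    length fewPresent * M
      ≤⟨ *-monoˡ-≤ M (length-filter few? (partitionsBelow N)) ⟩
    length (partitionsBelow N) * M ∎
    where
    open ≤-Reasoning
    open SwapData
    open Swap
    swap : Vec ℕ N × ℕ → Vec ℕ N × ℕ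
    swap (v , a) = update (update v (largestPart v) (_∸ 1)) a suc , a
    many-missing : ∀ {v} → v ∈ poorBig → length (allowedUpTo A k) ∸ M ≤ length (missing v)
    many-missing {v} q with (_ , few) ← ∈-poor⁻ (proj₁ (∈-filter⁻ big? {xs = poor} q)) = begin
      length (allowedUpTo A k) ∸ M                         ≤⟨ ∸-monoʳ-≤ (length (allowedUpTo A k)) (<⇒≤ few) ⟩
      length (allowedUpTo A k) ∸ length (present v)        ≡⟨ cong (_∸ length (present v)) (length-filter-∁ (absent? v) (allowedUpTo A k)) ⟨
      length (missing v) + length (present v) ∸ length (present v) ≡⟨ m+n∸n≡m (length (missing v)) (length (present v)) ⟩
      length (missing v)                                   ∎
    unique : Unique (pairs poorBig missing)
    unique = pairs-unique poorBig missing
      (Unique.filter⁺ big? poor-unique)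
      missing-unique
    into : ∀ {p} → p ∈ pairs poorBig missing → swap p ∈ pairs fewPresent present
    into {v , a} q = ∈-pairs⁺
      (∈-filter⁺ few? (∈-partitionsBelow (swapped d) (swapped-parts d) (swapped-lighter d)) (swapped-few d))
      (∈-present⁺ {swapped d} (a-allowed d) (swapped-has-a d))
      where d = swapData q
    injective : ∀ {p p′} → p ∈ pairs poorBig missing → p′ ∈ pairs poorBig missing → swap p ≡ swap p′ → p ≡ p′
    injective {v , a} {v′ , a′} q q′ eq with refl ← cong proj₂ eq =
      cong (_, a) (swap-injective (swapData q) (swapData q′) (cong proj₁ eq))

  module _ (1≤k : 1 ≤ k) (heavy : k * M * (k * k) ≤ N) where

    poorSmallSteps labelledBelow : List (Vec ℕ N × ℕ)
    poorSmallSteps = pairs poorSmall (λ _ → upTo (k * M))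
    labelledBelow = pairs (partitionsBelow {A} N) (λ _ → applyUpTo suc k)

    mostFrequent : Vec ℕ N → ℕ
    mostFrequent v = argmax (mult v) 1 (applyUpTo suc k)

    record PeelData (v : Vec ℕ N) (t : ℕ) : Set where
      field
        weight-v : weight v ≡ N
        parts-v : PartsIn A v
        small : largestPart v ≤ k
        t<kM : t < k * M

    peelData : ∀ {v t} → (v , t) ∈ poorSmallSteps → PeelData v t
    peelData {v} q
      with v∈ , t∈ ← ∈-pairs⁻ poorSmall (λ _ → upTo (k * M)) q
      with v∈poor , not-big ← ∈-filter⁻ (∁? big?) {xs = poor} v∈
      with (weight-v , parts-v) , _ ← ∈-poor⁻ v∈poor =
      record { weight-v = weight-v ; parts-v = parts-v ; small = ≮⇒≥ not-big ; t<kM = ∈-upTo⁻ t∈ }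

    -- A poor partition with all parts ≤ k has some part a ≤ k of multiplicity at
    -- least N / k² ≥ k M; it loses t + 1 copies of it, and t is recovered from the weight.
    module Peel {v : Vec ℕ N} {t : ℕ} (d : PeelData v t) where
      open PeelData d

      a : ℕ
      a = mostFrequent v

      a-range : 1 ≤ a × a ≤ k
      a-range = argmax-all (mult v) {P = λ a → 1 ≤ a × a ≤ k} (≤-refl , 1≤k)
        (All.tabulate λ q → let (i , i<k , eq) = ∈-applyUpTo⁻ suc q in subst (λ a → 1 ≤ a × a ≤ k) (sym eq) (s≤s z≤n , i<k))

      a≤N : a ≤ N
      a≤N = ≤-trans (proj₂ a-range) k≤N

      maximal : ∀ x → mult v x ≤ mult v a
      maximal zero = subst (_≤ mult v a) (sym (mult-zero v)) z≤n
      maximal (suc x) with suc x ≤? k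
      ... | yes x<k = All.lookup (f[xs]≤f[argmax] {f = mult v} 1 (applyUpTo suc k)) (∈-applyUpTo⁺ suc x<k)
      ... | no x≮k = subst (_≤ mult v a) (sym (mult-above-largestPart v (<-≤-trans (s≤s small) (≰⇒> x≮k)))) z≤n

      frequent : k * M ≤ mult v a
      frequent = *-cancelʳ-≤ (k * M) (mult v a) (k * k) {{>-nonZero (*-mono-≤ 1≤k 1≤k)}} (begin
        k * M * (k * k)                                    ≤⟨ heavy ⟩
        N                                                  ≡⟨ weight-v ⟨
        weight v                                           ≤⟨ weight-≤ v (mult v a) maximal ⟩
        mult v a * (largestPart v * largestPart v)         ≤⟨ *-monoʳ-≤ (mult v a) (*-mono-≤ small small) ⟩
        mult v a * (k * k)                                 ∎)
        where open ≤-Reasoning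

      peeled : Vec ℕ N
      peeled = update v a (_∸ suc t)

      suc-t≤mult : suc t ≤ mult v a
      suc-t≤mult = ≤-trans t<kM frequent

      peeled-weight : weight peeled + a * suc t ≡ N
      peeled-weight = trans (weight-remove v (suc t) suc-t≤mult a≤N) weight-v

      peeled-∈ : peeled ∈ partitionsBelow N
      peeled-∈ = removal-∈-partitionsBelow v (suc t) parts-v weight-v (proj₁ a-range) a≤N (s≤s z≤n) suc-t≤mult

    peel-injective : ∀ {v t v′ t′} (d : PeelData v t) (d′ : PeelData v′ t′) →
      mostFrequent v ≡ mostFrequent v′ → Peel.peeled d ≡ Peel.peeled d′ → v ≡ v′ × t ≡ t′
    peel-injective {v} {t} {v′} {t′} d d′ a≡ peeled≡ = v≡v′ , t≡t′
      where
      open Peel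
      1≤a = proj₁ (a-range d)
      t≡t′ : t ≡ t′
      t≡t′ = suc-injective (*-cancelˡ-≡ (suc t) (suc t′) (a d) {{>-nonZero 1≤a}}
        (+-cancelˡ-≡ (weight (peeled d)) _ _ (trans (peeled-weight d) (trans (sym (peeled-weight d′))
          (cong₂ (λ u c → weight u + c * suc t′) (sym peeled≡) (sym a≡))))))
      v≡v′ : v ≡ v′
      v≡v′ = update-injective v v′ (_∸ suc t) 1≤a (a≤N d) (∸-cancelʳ-≡ (suc-t≤mult d) enough′)
        (trans peeled≡ (cong₂ (λ c s → update v′ c (_∸ suc s)) (sym a≡) (sym t≡t′)))
        where
        enough′ : suc t ≤ mult v′ (a d)
        enough′ = subst₂ (λ s c → suc s ≤ mult v′ c) (sym t≡t′) (sym a≡) (suc-t≤mult d′)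

    count-poorSmall : length poorSmall * (k * M) ≤ length (partitionsBelow {A} N) * k
    count-poorSmall = begin
      length poorSmall * (k * M)
        ≤⟨ length-pairs-≥ poorSmall (λ _ → upTo (k * M)) (k * M) (λ _ → ≤-reflexive (sym (length-upTo (k * M)))) ⟩
      length poorSmallSteps
        ≤⟨ length-≤-injection poorSmallSteps labelledBelow peel unique into injective ⟩
      length labelledBelow
        ≤⟨ length-pairs-≤ (partitionsBelow N) (λ _ → applyUpTo suc k) k (λ _ → ≤-reflexive (length-applyUpTo suc k)) ⟩
      length (partitionsBelow N) * k ∎
      where
      open ≤-Reasoning
      open Peel
      peel : Vec ℕ N × ℕ → Vec ℕ N × ℕ
      peel (v , t) = update v (mostFrequent v) (_∸ suc t) , mostFrequent v
      unique : Unique poorSmallSteps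
      unique = pairs-unique poorSmall (λ _ → upTo (k * M))
        (Unique.filter⁺ (∁? big?) poor-unique)
        (λ _ → Unique.upTo⁺ (k * M))
      into : ∀ {p} → p ∈ poorSmallSteps → peel p ∈ labelledBelow
      into q = let d = peelData q in ∈-pairs⁺ (peeled-∈ d) (∈-applyUpTo-suc⁺ (proj₁ (a-range d)) (proj₂ (a-range d)))
      injective : ∀ {p p′} → p ∈ poorSmallSteps → p′ ∈ poorSmallSteps → peel p ≡ peel p′ → p ≡ p′
      injective q q′ eq =
        let (v≡v′ , t≡t′) = peel-injective (peelData q) (peelData q′) (cong proj₂ eq) (cong proj₁ eq)
        in cong₂ _,_ v≡v′ t≡t′

  partitions-bound : 1 ≤ k → 1 ≤ M → M * M ≤ length (allowedUpTo A k) ∸ M → k * M * (k * k) ≤ N →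
                     length partitions * M ≤ 3 * length (partitionsBelow {A} N)
  partitions-bound 1≤k 1≤M enough heavy = begin
    length partitions * M
      ≡⟨ cong (_* M) split ⟨
    (length rich + (length poorBig + length poorSmall)) * M
      ≡⟨ distribute (length rich) (length poorBig) (length poorSmall) M ⟩
    length rich * M + (length poorBig * M + length poorSmall * M)
      ≤⟨ +-mono-≤ count-rich (+-mono-≤ poorBig-bound poorSmall-bound) ⟩
    Y + (Y + Y)
      ≡⟨ thrice Y ⟩
    3 * Y ∎
    where
    open ≤-Reasoning
    Y = length (partitionsBelow {A} N)
    split : length rich + (length poorBig + length poorSmall) ≡ length partitions
    split = trans (cong (length rich +_) (length-filter-∁ big? poor))
                  (length-filter-∁ rich? partitions)
    distribute : ∀ r b s m → (r + (b + s)) * m ≡ r * m + (b * m + s * m)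
    distribute = solve 4 (λ r b s m → (r :+ (b :+ s)) :* m := r :* m :+ (b :* m :+ s :* m)) refl
    thrice : ∀ y → y + (y + y) ≡ 3 * y
    thrice = solve 1 (λ y → y :+ (y :+ y) := con 3 :* y) refl
    poorBig-bound : length poorBig * M ≤ Y
    poorBig-bound = *-cancelʳ-≤ (length poorBig * M) Y M {{>-nonZero 1≤M}} (begin
      length poorBig * M * M                          ≡⟨ *-assoc (length poorBig) M M ⟩
      length poorBig * (M * M)                        ≤⟨ *-monoʳ-≤ (length poorBig) enough ⟩
      length poorBig * (length (allowedUpTo A k) ∸ M) ≤⟨ count-poorBig ⟩
      Y * M                                           ∎)
    poorSmall-bound : length poorSmall * M ≤ Y
    poorSmall-bound = *-cancelʳ-≤ (length poorSmall * M) Y k {{>-nonZero 1≤k}} (begin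
      length poorSmall * M * k   ≡⟨ trans (*-assoc (length poorSmall) M k) (cong (length poorSmall *_) (*-comm M k)) ⟩
      length poorSmall * (k * M) ≤⟨ count-poorSmall 1≤k heavy ⟩
      Y * k                      ∎)

module _ {A : Subset} where

  private
    P? = λ a → A a Bool.≟ true

  length-allowedUpTo-suc : ∀ j → length (allowedUpTo A (suc j)) ≡ length (allowedUpTo A j) + length (filter P? (suc j ∷ []))
  length-allowedUpTo-suc j = begin
    length (filter P? (applyUpTo suc (suc j)))                      ≡⟨ cong (length ∘ filter P?) (applyUpTo-∷ʳ suc j) ⟨
    length (filter P? (applyUpTo suc j ++ suc j ∷ []))              ≡⟨ cong length (filter-++ P? (applyUpTo suc j) (suc j ∷ [])) ⟩
    length (filter P? (applyUpTo suc j) ++ filter P? (suc j ∷ []))  ≡⟨ length-++ (filter P? (applyUpTo suc j)) ⟩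
    length (allowedUpTo A j) + length (filter P? (suc j ∷ []))      ∎
    where open ≡-Reasoning

  allowedUpTo-mono : ∀ {j j′} → j ≤′ j′ → length (allowedUpTo A j) ≤ length (allowedUpTo A j′)
  allowedUpTo-mono ≤′-refl = ≤-refl
  allowedUpTo-mono {j′ = suc j′} (≤′-step j≤′j′) =
    ≤-trans (allowedUpTo-mono j≤′j′) (≤-trans (m≤m+n _ _) (≤-reflexive (sym (length-allowedUpTo-suc j′))))

  length-allowedUpTo-hit : ∀ j → A (suc j) ≡ true → length (allowedUpTo A (suc j)) ≡ suc (length (allowedUpTo A j))
  length-allowedUpTo-hit j a∈A = trans (length-allowedUpTo-suc j)
    (trans (cong (λ xs → length (allowedUpTo A j) + length xs) (filter-accept P? a∈A)) (+-comm _ 1))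

  allowedUpTo-unbounded : Infinite A → ∀ L → ∃[ k ] L ≤ length (allowedUpTo A k)
  allowedUpTo-unbounded inf zero = 0 , z≤n
  allowedUpTo-unbounded inf (suc L)
    with k , L≤ ← allowedUpTo-unbounded inf L
    with suc j , s≤s k≤j , a∈A ← inf (suc k) =
    suc j , subst (suc L ≤_) (sym (length-allowedUpTo-hit j a∈A)) (s≤s (≤-trans L≤ (allowedUpTo-mono (≤⇒≤′ k≤j))))

p-eventually-small : ∀ {A} → Infinite A → ∀ M → 1 ≤ M → ∃[ n₀ ] ∀ n → n₀ ≤ n → p A (suc n) * M ≤ 3 * S A n
p-eventually-small {A} inf M 1≤M with allowedUpTo-unbounded inf (M * M + M)
... | zero , enough = ⊥-elim (n≮0 (≤-trans (≤-trans 1≤M (m≤n+m M (M * M))) enough))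
... | k@(suc _) , enough = k * M * (k * k) + k , bound
  where
  bound : ∀ n → k * M * (k * k) + k ≤ n → p A (suc n) * M ≤ 3 * S A n
  bound n n₀≤n = subst₂ (λ x y → x * M ≤ 3 * y) (length-partitionVectors (suc n) (suc n) ≤-refl) (length-partitionsBelow n)
    (Injections.partitions-bound A k M (≤-trans (m≤n+m k _) (m≤n⇒m≤1+n n₀≤n))
       (s≤s z≤n) 1≤M (m+n≤o⇒m≤o∸n (M * M) enough) (≤-trans (m≤m+n _ k) (m≤n⇒m≤1+n n₀≤n)))

S-mono : ∀ A {m n} → m ≤ n → S A m ≤ S A n
S-mono A {m} {n} m≤n = go (≤⇒≤′ m≤n)
  where
  go : ∀ {n} → m ≤′ n → S A m ≤ S A n
  go ≤′-refl = ≤-refl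
  go (≤′-step m≤′n) = ≤-trans (go m≤′n) (m≤m+n _ _)

S-growth : ∀ A M n → (∀ m → n ≤ m → p A (suc m) * M ≤ 3 * S A m) →
           ∀ j → S A (n + j) * M ≤ S A n * M + 3 * j * S A (n + j)
S-growth A M n small zero rewrite +-identityʳ n = m≤m+n _ 0
S-growth A M n small (suc j) rewrite +-suc n j = begin
  (S A (n + j) + p A (suc (n + j))) * M
    ≡⟨ *-distribʳ-+ M (S A (n + j)) _ ⟩
  S A (n + j) * M + p A (suc (n + j)) * M
    ≤⟨ +-mono-≤ (S-growth A M n small j) (small (n + j) (m≤m+n n j)) ⟩
  S A n * M + 3 * j * S A (n + j) + 3 * S A (n + j)
    ≡⟨ regroup (S A n * M) j (S A (n + j)) ⟩
  S A n * M + 3 * suc j * S A (n + j)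
    ≤⟨ +-monoʳ-≤ (S A n * M) (*-monoʳ-≤ (3 * suc j) (S-mono A (n≤1+n (n + j)))) ⟩
  S A n * M + 3 * suc j * S A (suc (n + j)) ∎
  where
  open ≤-Reasoning
  regroup : ∀ x j s → x + 3 * j * s + 3 * s ≡ x + 3 * suc j * s
  regroup = solve 3 (λ x j s → x :+ con 3 :* j :* s :+ con 3 :* s := x :+ con 3 :* (con 1 :+ j) :* s) refl

numerator-pos : ∀ ε → 0ℚ ℚ.< ε → 1 ≤ ℤ.∣ ↥ ε ∣
numerator-pos (mkℚ (pos (suc e)) _ _) _ = s≤s z≤n
numerator-pos (mkℚ (pos zero) _ _) (ℚ.*<* (+<+ ()))
numerator-pos (mkℚ -[1+ _ ] _ _) (ℚ.*<* ())

-- The last hypothesis says s₁ / s₀ < 1 + ε = (↥ ε + ↧ ε) / ↧ ε, cross-multiplied.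
ratio-close : ∀ s₀ s₁ .{{_ : ℕ.NonZero s₀}} ε → 0ℚ ℚ.< ε → s₀ ≤ s₁ →
              s₁ * ↧ₙ ε < (ℤ.∣ ↥ ε ∣ + ↧ₙ ε) * s₀ → ℚ.∣ (pos s₁) ℚ./ s₀ ℚ.- 1ℚ ∣ ℚ.< ε
ratio-close (suc s₀) s₁ ε@(mkℚ (pos (suc e)) d _) _ s₀≤s₁ s₁<[1+ε]s₀ =
  subst (ℚ._< ε) (sym (ℚ.0≤p⇒∣p∣≡p 0≤x-1)) x-1<ε
  where
  x = (pos s₁) ℚ./ suc s₀
  x≃ : toℚᵘ x ℚᵘ.≃ ℚᵘ.mkℚᵘ (pos s₁) s₀
  x≃ = ℚ.toℚᵘ-fromℚᵘ (ℚᵘ.mkℚᵘ (pos s₁) s₀)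
  1≤x : 1ℚ ℚ.≤ x
  1≤x = ℚ.toℚᵘ-cancel-≤ (ℚᵘ.≤-respʳ-≃ (ℚᵘ.≃-sym x≃) (ℚᵘ.*≤*
    (subst₂ ℤ._≤_ (ℤ.pos-* 1 (suc s₀)) (ℤ.pos-* s₁ 1)
    (+≤+ (subst₂ _≤_ (sym (*-identityˡ (suc s₀))) (sym (*-identityʳ s₁)) s₀≤s₁)))))
  cross : pos s₁ ℤ.* pos (suc (d * 1)) ℤ.< (pos (suc e) ℤ.* pos 1 ℤ.+ pos 1 ℤ.* pos (suc d)) ℤ.* pos (suc s₀)
  cross = subst₂ ℤ._<_ (ℤ.pos-* s₁ (suc (d * 1)))
    (trans (ℤ.pos-* (suc e * 1 + 1 * suc d) (suc s₀))
      (cong (ℤ._* pos (suc s₀)) (trans (ℤ.pos-+ (suc e * 1) (1 * suc d))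
        (cong₂ ℤ._+_ (ℤ.pos-* (suc e) 1) (ℤ.pos-* 1 (suc d))))))
    (+<+ (subst₂ _<_ (cong (λ m → s₁ * suc m) (sym (*-identityʳ d)))
      (cong (_* suc s₀) (cong₂ _+_ (sym (*-identityʳ (suc e))) (sym (*-identityˡ (suc d))))) s₁<[1+ε]s₀))
  x<ε+1 : x ℚ.< ε ℚ.+ 1ℚ
  x<ε+1 = ℚ.toℚᵘ-cancel-< (ℚᵘ.<-respˡ-≃ (ℚᵘ.≃-sym x≃)
    (ℚᵘ.<-respʳ-≃ (ℚᵘ.≃-sym (ℚ.toℚᵘ-homo-+ ε 1ℚ)) (ℚᵘ.*<* cross)))
  0≤x-1 : 0ℚ ℚ.≤ x ℚ.- 1ℚ
  0≤x-1 = subst (ℚ._≤ x ℚ.- 1ℚ) (ℚ.+-inverseʳ 1ℚ) (ℚ.+-monoˡ-≤ (ℚ.- 1ℚ) 1≤x)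
  x-1<ε : x ℚ.- 1ℚ ℚ.< ε
  x-1<ε = subst (x ℚ.- 1ℚ ℚ.<_)
    (trans (ℚ.+-assoc ε 1ℚ (ℚ.- 1ℚ)) (trans (cong (ε ℚ.+_) (ℚ.+-inverseʳ 1ℚ)) (ℚ.+-identityʳ ε)))
    (ℚ.+-monoˡ-< (ℚ.- 1ℚ) x<ε+1)
ratio-close (suc s₀) s₁ (mkℚ (pos zero) _ _) (ℚ.*<* (+<+ ())) _ _
ratio-close (suc s₀) s₁ (mkℚ -[1+ _ ] _ _) (ℚ.*<* ()) _ _

cross-multiplied : ∀ d n a s₀ s₁ → 1 ≤ n → 1 ≤ s₀ →
  s₁ * (d * suc a + a) ≤ s₀ * (d * suc a + a) + a * s₁ → s₁ * d < (n + d) * s₀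
cross-multiplied d n a s₀ s₁ 1≤n 1≤s₀ growth = *-cancelʳ-< (suc a) (s₁ * d) ((n + d) * s₀) (begin-strict
  s₁ * d * suc a                   ≡⟨ *-assoc s₁ d (suc a) ⟩
  s₁ * (d * suc a)                 ≤⟨ +-cancelʳ-≤ (a * s₁) _ _ (subst (_≤ s₀ * (d * suc a + a) + a * s₁) split growth) ⟩
  s₀ * (d * suc a + a)             <⟨ *-monoʳ-< s₀ {{>-nonZero 1≤s₀}} (+-monoʳ-< (d * suc a) a<n[1+a]) ⟩
  s₀ * (d * suc a + n * suc a)     ≡⟨ regroup s₀ d n (suc a) ⟩
  (n + d) * s₀ * suc a             ∎)
  where
  open ≤-Reasoning
  split : s₁ * (d * suc a + a) ≡ s₁ * (d * suc a) + a * s₁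
  split = trans (*-distribˡ-+ s₁ (d * suc a) a) (cong (s₁ * (d * suc a) +_) (*-comm s₁ a))
  a<n[1+a] : a < n * suc a
  a<n[1+a] = ≤-trans (n<1+n a) (≤-trans (≤-reflexive (sym (*-identityˡ (suc a)))) (*-monoˡ-≤ (suc a) 1≤n))
  regroup : ∀ s d n b → s * (d * b + n * b) ≡ (n + d) * s * b
  regroup = solve 4 (λ s d n b → s :* (d :* b :+ n :* b) := (n :+ d) :* s :* b) refl

lemma3p2 : (A : Subset) → PositiveSubset A → Infinite A → GcdOne A → (h : ℕ) → ConvergesTo (ratio A (suc h)) 1ℚ
lemma3p2 A _ inf _ h ε@(mkℚ _ _ _) 0<ε = n₀ , close
  where
  a M : ℕ
  a = 3 * suc h
  M = ↧ₙ ε * suc a + a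
  eventually : ∃[ n₀ ] ∀ n → n₀ ≤ n → p A (suc n) * M ≤ 3 * S A n
  eventually = p-eventually-small inf M (s≤s z≤n)
  n₀ = proj₁ eventually
  close : ∀ n → n₀ ≤ n → ℚ.∣ ratio A (suc h) n ℚ.- 1ℚ ∣ ℚ.< ε
  close n n₀≤n =
    ratio-close (S A n) (S A (n + suc h)) {{ℕ.>-nonZero (S≥1 A n)}} ε 0<ε (S-mono A (m≤m+n n (suc h)))
      (cross-multiplied (↧ₙ ε) (ℤ.∣ ↥ ε ∣) a (S A n) (S A (n + suc h)) (numerator-pos ε 0<ε) (S≥1 A n)
        (S-growth A M n (λ m n≤m → proj₂ eventually m (≤-trans n₀≤n n≤m)) (suc h)))
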